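{- Let $P$ be a finite $(3+1)$-free poset with incomparability graph $G$, let $a,b,c,d$ induce a $(2+2)$ subposet of $P$ with $a<_Pc$, $b<_Pd$, and let $(V_1,V_2)$ be a pair of subsets of $P$ that is maximal with respect to inclusion among pairs satisfying conditions (a)–(e) below. Write $V_1=\{v_1,\dots,v_m\}$, $V_2=\{w_1,\dots,w_n\}$, let $k\in\{0,1,\dots,m\}$, and let $H_k$ be the graph with vertex set $P$ whose edges are the edges of $G$ having at least one endpoint outside $V_1\cup V_2$, together with all pairs $v_iv_j$ ($i<j$), all pairs $w_iw_j$ ($i<j$), and all pairs $v_iw_j$ with $1\le i\le k$ and $1\le j\le n$. Then $H_k$ is the incomparability graph of a $(3+1)$-free poset. Conditions: (a) $a,b\in V_1$, $c,d\in V_2$; (b) elements of $V_1$ are pairwise incomparable, and elements of $V_2$ are pairwise incomparable; (c) for every nonempty $A\subsetneq V_1$ there is an induced $(2+2)$ subposet with one element in $A$, one in $V_1\setminus A$, two in $V_2$; (d) for every nonempty $B\subsetneq V_2$ there is an induced $(2+2)$ subposet with one element in $B$, one in $V_2\setminus B$, two in $V_1$; (e) for all $x\in V_1$, $y\in V_2$, either $x<_Py$ or $x,y$ are incomparable.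
   Context: The $(3+1)$ poset has elements $a,b,c,d$ with $a<b<c$ and $d$ incomparable to the others; the $(2+2)$ poset has $a<c$, $b<d$ and no other strict relations. A poset is $Q$-free if it has no induced subposet isomorphic to $Q$. The incomparability graph of a poset is the simple graph on its elements with two distinct elements adjacent iff they are incomparable. "Maximal with respect to inclusion" means no other pair $(V_1',V_2')$ satisfying (a)–(e) has $V_1\subseteq V_1'$ and $V_2\subseteq V_2'$. -}

module Defs where

open import Data.Nat using (ℕ; _<_)
open import Data.Fin using (Fin; toℕ)
open import Data.Fin.Subset using (Subset; _∈_; _∉_; _⊆_; _⊂_; _─_; Nonempty)
open import Data.List using (List; []; _∷_)
open import Data.List.Relation.Binary.Permutation.Propositional using (_↭_)
open import Data.Product using (Σ; ∃; _×_; _,_)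
open import Data.Sum using (_⊎_)
open import Data.Empty using (⊥)
open import Relation.Binary.PropositionalEquality using (_≡_; _≢_)
open import Relation.Nullary using (¬_; Dec)
open import Function.Definitions using (Injective)

record FinPoset (N : ℕ) : Set₁ where
  field
    _<P_    : Fin N → Fin N → Set
    irrefl  : ∀ x → ¬ (x <P x)
    trans   : ∀ {x y z} → x <P y → y <P z → x <P z
    dec     : ∀ x y → Dec (x <P y)

open FinPoset public

Incomp : ∀ {N} → FinPoset N → Fin N → Fin N → Set
Incomp P x y = x ≢ y × ¬ (_<P_ P x y) × ¬ (_<P_ P y x)

ThreePlusOneFree : ∀ {N} → FinPoset N → Set
ThreePlusOneFree P = ∀ x y z w → _<P_ P x y → _<P_ P y z →
  Incomp P w x → Incomp P w y → Incomp P w z → ⊥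

TwoPlusTwo : ∀ {N} → FinPoset N → Fin N → Fin N → Fin N → Fin N → Set
TwoPlusTwo P a b c d =
  _<P_ P a c × _<P_ P b d ×
  Incomp P a b × Incomp P a d × Incomp P b c × Incomp P c d

Induces22 : ∀ {N} → FinPoset N → Fin N → Fin N → Fin N → Fin N → Set
Induces22 P p q r s = Σ (Fin _) λ a → Σ (Fin _) λ b → Σ (Fin _) λ c → Σ (Fin _) λ d →
  ((a ∷ b ∷ c ∷ d ∷ []) ↭ (p ∷ q ∷ r ∷ s ∷ [])) × TwoPlusTwo P a b c d

Conditions : ∀ {N} → FinPoset N → (a b c d : Fin N) → Subset N → Subset N → Set
Conditions P a b c d V₁ V₂ =
  (a ∈ V₁ × b ∈ V₁ × c ∈ V₂ × d ∈ V₂) ×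
  (∀ x y → x ∈ V₁ → y ∈ V₁ → x ≢ y → Incomp P x y) ×
  (∀ x y → x ∈ V₂ → y ∈ V₂ → x ≢ y → Incomp P x y) ×
  (∀ A → Nonempty A → A ⊂ V₁ → ∃ λ p → ∃ λ q → ∃ λ r → ∃ λ s →
     p ∈ A × q ∈ (V₁ ─ A) × r ∈ V₂ × s ∈ V₂ × Induces22 P p q r s) ×
  (∀ B → Nonempty B → B ⊂ V₂ → ∃ λ p → ∃ λ q → ∃ λ r → ∃ λ s →
     p ∈ B × q ∈ (V₂ ─ B) × r ∈ V₁ × s ∈ V₁ × Induces22 P p q r s) ×
  (∀ x y → x ∈ V₁ → y ∈ V₂ → _<P_ P x y ⊎ Incomp P x y)

MaximalPair : ∀ {N} → FinPoset N → (a b c d : Fin N) → Subset N → Subset N → Set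
MaximalPair P a b c d V₁ V₂ =
  Conditions P a b c d V₁ V₂ ×
  (∀ V₁' V₂' → Conditions P a b c d V₁' V₂' → V₁ ⊆ V₁' → V₂ ⊆ V₂' →
     V₁' ≡ V₁ × V₂' ≡ V₂)

Enumerates : ∀ {N m} → (Fin m → Fin N) → Subset N → Set
Enumerates {N} {m} v V = Injective _≡_ _≡_ v × (∀ x → (x ∈ V → ∃ λ i → v i ≡ x) × (∀ i → v i ≡ x → x ∈ V))

HEdge : ∀ {N m} → FinPoset N → Subset N → Subset N → (Fin m → Fin N) → ℕ →
        Fin N → Fin N → Set
HEdge P V₁ V₂ v k x y = x ≢ y ×
  ( (Incomp P x y × ((x ∉ V₁ × x ∉ V₂) ⊎ (y ∉ V₁ × y ∉ V₂)))
  ⊎ (x ∈ V₁ × y ∈ V₁)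
  ⊎ (x ∈ V₂ × y ∈ V₂)
  ⊎ ((∃ λ i → toℕ i < k × v i ≡ x) × y ∈ V₂)
  ⊎ ((∃ λ i → toℕ i < k × v i ≡ y) × x ∈ V₂) )

IsIncomparabilityGraphOf : ∀ {N} → (Fin N → Fin N → Set) → FinPoset N → Set
IsIncomparabilityGraphOf H Q = ∀ x y → (H x y → Incomp Q x y) × (Incomp Q x y → H x y)

-- Q is P with the relations between V₁ and V₂ rewired: for x ∈ V₁ and y ∈ V₂ put
-- x <_Q y exactly when x is not among v₁, …, v_k, and order all other pairs as in P.
-- Its incomparability graph is H_k. That Q is a (3+1)-free poset rests on uniformity
-- properties of (V₁, V₂): an element below one point of V₁ is below all of V₁ and then
-- below all of V₂, dually for V₂, and no element lies strictly between V₁ and V₂.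
-- Each is proved by applying condition (c) to A = {u ∈ V₁ ∣ R u} for a suitable
-- predicate R: the (2+2) it provides, together with the offending element, would
-- form a (3+1) in P. The statements about V₂ are the order duals of those about V₁.
module Submission where

open import Defs
open import Data.Nat using (ℕ; _≤_)
open import Data.Fin using (Fin)
open import Data.Fin.Subset using (Subset)
open import Data.Product using (Σ; _×_)

import Data.Nat as ℕ
open import Data.Fin using (toℕ)
open import Data.Fin.Properties using (any?) renaming (_≟_ to _≟ᶠ_)
open import Data.Fin.Subset using (_∈_; _∉_; _∩_; _─_; _⊂_; Nonempty; outside)
open import Data.Fin.Subset.Properties using (_∈?_; x∈p∩q⁺; x∈p∩q⁻; p∩q⊆p; p─q⊆p)
open import Data.Vec using (_∷_; here; there; tabulate)
open import Data.Vec.Properties using (lookup⇒[]=; []=⇒lookup; lookup∘tabulate)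
open import Data.List using ([]; _∷_)
open import Data.List.Relation.Unary.All using ([]; _∷_)
open import Data.List.Relation.Unary.Any using (here; there)
open import Data.List.Membership.Propositional using () renaming (_∈_ to _∈ₗ_)
open import Data.List.Relation.Binary.Permutation.Propositional using (↭-sym; ↭-trans)
open import Data.List.Relation.Binary.Permutation.Propositional.Properties
  using (++-comm; All-resp-↭; ∈-resp-↭)
open import Data.Product using (∃; _,_; proj₁; proj₂)
import Data.Product as Product
open import Data.Sum using (_⊎_; inj₁; inj₂; [_,_])
import Data.Sum as Sum
open import Data.Empty using (⊥; ⊥-elim)
open import Relation.Nullary using (¬_; Dec; does; yes; no; contradiction)
open import Relation.Nullary.Decidable using (dec-true; _×-dec_; _⊎-dec_; ¬?; decidable-stable)
open import Relation.Unary using (Pred; Decidable)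
open import Relation.Binary.PropositionalEquality using (_≡_; _≢_; refl; sym) renaming (trans to ≡-trans)
open import Function using (_∘_; flip)

x∈p─q⇒x∉q : ∀ {n} {p q : Subset n} {x} → x ∈ p ─ q → x ∉ q
x∈p─q⇒x∉q {p = _ ∷ _} {outside ∷ _} here = λ ()
x∈p─q⇒x∉q {p = _ ∷ _} {_ ∷ _} (there x∈p─q) (there x∈q) = x∈p─q⇒x∉q x∈p─q x∈q

module _ {n ℓ} {R : Pred (Fin n) ℓ} (R? : Decidable R) where

  fromDec : Subset n
  fromDec = tabulate (does ∘ R?)

  ∈-fromDec⁺ : ∀ {x} → R x → x ∈ fromDec
  ∈-fromDec⁺ {x} r = lookup⇒[]= x fromDec (≡-trans (lookup∘tabulate (does ∘ R?) x) (dec-true (R? x) r))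

  ∈-fromDec⁻ : ∀ {x} → x ∈ fromDec → R x
  ∈-fromDec⁻ {x} x∈ with R? x | ≡-trans (sym (lookup∘tabulate (does ∘ R?) x)) ([]=⇒lookup x∈)
  ... | yes r | _ = r
  ... | no _ | ()

module Order {N} (P : FinPoset N) where
  open FinPoset P public using ()
    renaming (_<P_ to _<_; trans to <-trans; irrefl to <-irrefl; dec to _<?_)

  infix 4 _∥_
  _∥_ : Fin N → Fin N → Set
  _∥_ = Incomp P

  ∥⇒≮ : ∀ {x y} → x ∥ y → ¬ x < y
  ∥⇒≮ (_ , x≮y , _) = x≮y

  ∥⇒≯ : ∀ {x y} → x ∥ y → ¬ y < x
  ∥⇒≯ (_ , _ , y≮x) = y≮x

  ∥-sym : ∀ {x y} → x ∥ y → y ∥ x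
  ∥-sym (x≢y , x≮y , y≮x) = x≢y ∘ sym , y≮x , x≮y

_ᵒᵖ : ∀ {N} → FinPoset N → FinPoset N
P ᵒᵖ = record
  { _<P_   = flip (_<P_ P)
  ; irrefl = irrefl P
  ; trans  = flip (trans P)
  ; dec    = flip (dec P)
  }

Incomp-ᵒᵖ : ∀ {N} (P : FinPoset N) {x y} → Incomp P x y → Incomp (P ᵒᵖ) x y
Incomp-ᵒᵖ _ (x≢y , x≮y , y≮x) = x≢y , y≮x , x≮y

module _ {N} (P : FinPoset N) where
  open Order P

  ThreePlusOneFree-ᵒᵖ : ThreePlusOneFree P → ThreePlusOneFree (P ᵒᵖ)
  ThreePlusOneFree-ᵒᵖ free x y z w y<x z<y w∥x w∥y w∥z =
    free z y x w z<y y<x (Incomp-ᵒᵖ (P ᵒᵖ) w∥z) (Incomp-ᵒᵖ (P ᵒᵖ) w∥y) (Incomp-ᵒᵖ (P ᵒᵖ) w∥x)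

  TwoPlusTwo-swap : ∀ {a b c d} → TwoPlusTwo P a b c d → TwoPlusTwo P b a d c
  TwoPlusTwo-swap (a<c , b<d , a∥b , a∥d , b∥c , c∥d) = b<d , a<c , ∥-sym a∥b , b∥c , a∥d , ∥-sym c∥d

  TwoPlusTwo-ᵒᵖ : ∀ {a b c d} → TwoPlusTwo P a b c d → TwoPlusTwo (P ᵒᵖ) c d a b
  TwoPlusTwo-ᵒᵖ (a<c , b<d , a∥b , a∥d , b∥c , c∥d) =
    a<c , b<d , Incomp-ᵒᵖ P c∥d , Incomp-ᵒᵖ P (∥-sym b∥c) , Incomp-ᵒᵖ P (∥-sym a∥d) , Incomp-ᵒᵖ P a∥b

  Induces22-ᵒᵖ : ∀ {p q r s} → Induces22 P p q r s → Induces22 (P ᵒᵖ) p q r s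
  Induces22-ᵒᵖ (a , b , c , d , abcd↭pqrs , abcd) =
    c , d , a , b , ↭-trans (++-comm (c ∷ d ∷ []) (a ∷ b ∷ [])) abcd↭pqrs , TwoPlusTwo-ᵒᵖ abcd

record Admissible (N : ℕ) : Set₁ where
  field
    P           : FinPoset N
    free        : ThreePlusOneFree P
    a b c d     : Fin N
    abcd        : TwoPlusTwo P a b c d
    V₁ V₂       : Subset N
    a∈V₁        : a ∈ V₁
    b∈V₁        : b ∈ V₁
    c∈V₂        : c ∈ V₂
    d∈V₂        : d ∈ V₂
    V₁-antichain : ∀ x y → x ∈ V₁ → y ∈ V₁ → x ≢ y → Incomp P x y
    V₂-antichain : ∀ x y → x ∈ V₂ → y ∈ V₂ → x ≢ y → Incomp P x y
    V₁-separated : ∀ A → Nonempty A → A ⊂ V₁ → ∃ λ p → ∃ λ q → ∃ λ r → ∃ λ s →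
      p ∈ A × q ∈ (V₁ ─ A) × r ∈ V₂ × s ∈ V₂ × Induces22 P p q r s
    V₂-separated : ∀ B → Nonempty B → B ⊂ V₂ → ∃ λ p → ∃ λ q → ∃ λ r → ∃ λ s →
      p ∈ B × q ∈ (V₂ ─ B) × r ∈ V₁ × s ∈ V₁ × Induces22 P p q r s
    V₁-below-V₂ : ∀ x y → x ∈ V₁ → y ∈ V₂ → _<P_ P x y ⊎ Incomp P x y

admissible : ∀ {N} (P : FinPoset N) → ThreePlusOneFree P → ∀ {a b c d} → TwoPlusTwo P a b c d →
  ∀ {V₁ V₂} → Conditions P a b c d V₁ V₂ → Admissible N
admissible P free abcd
  ((a∈V₁ , b∈V₁ , c∈V₂ , d∈V₂) , V₁-antichain , V₂-antichain , V₁-separated , V₂-separated , V₁-below-V₂) =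
  record
    { P = P ; free = free ; abcd = abcd
    ; a∈V₁ = a∈V₁ ; b∈V₁ = b∈V₁ ; c∈V₂ = c∈V₂ ; d∈V₂ = d∈V₂
    ; V₁-antichain = V₁-antichain ; V₂-antichain = V₂-antichain
    ; V₁-separated = V₁-separated ; V₂-separated = V₂-separated
    ; V₁-below-V₂ = V₁-below-V₂
    }

opposite : ∀ {N} → Admissible N → Admissible N
opposite 𝒜 = record
  { P = P ᵒᵖ ; free = ThreePlusOneFree-ᵒᵖ P free
  ; a = c ; b = d ; c = a ; d = b ; abcd = TwoPlusTwo-ᵒᵖ P abcd
  ; V₁ = V₂ ; V₂ = V₁
  ; a∈V₁ = c∈V₂ ; b∈V₁ = d∈V₂ ; c∈V₂ = a∈V₁ ; d∈V₂ = b∈V₁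
  ; V₁-antichain = λ x y x∈ y∈ x≢y → Incomp-ᵒᵖ P (V₂-antichain x y x∈ y∈ x≢y)
  ; V₂-antichain = λ x y x∈ y∈ x≢y → Incomp-ᵒᵖ P (V₁-antichain x y x∈ y∈ x≢y)
  ; V₁-separated = λ B B≠∅ B⊂V₂ → separated-ᵒᵖ (V₂-separated B B≠∅ B⊂V₂)
  ; V₂-separated = λ A A≠∅ A⊂V₁ → separated-ᵒᵖ (V₁-separated A A≠∅ A⊂V₁)
  ; V₁-below-V₂ = λ x y x∈V₂ y∈V₁ → Sum.map₂ (Incomp-ᵒᵖ P ∘ ∥-sym) (V₁-below-V₂ y x y∈V₁ x∈V₂)
  }
  where
  open Admissible 𝒜
  open Order P
  separated-ᵒᵖ : ∀ {X Y A} →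
    (∃ λ p → ∃ λ q → ∃ λ r → ∃ λ s → p ∈ A × q ∈ (X ─ A) × r ∈ Y × s ∈ Y × Induces22 P p q r s) →
    (∃ λ p → ∃ λ q → ∃ λ r → ∃ λ s → p ∈ A × q ∈ (X ─ A) × r ∈ Y × s ∈ Y × Induces22 (P ᵒᵖ) p q r s)
  separated-ᵒᵖ (p , q , r , s , p∈A , q∈X─A , r∈Y , s∈Y , pqrs) =
    p , q , r , s , p∈A , q∈X─A , r∈Y , s∈Y , Induces22-ᵒᵖ P pqrs

module LowerSide {N} (𝒜 : Admissible N) where
  open Admissible 𝒜
  open Order P

  InV : Fin N → Set
  InV x = x ∈ V₁ ⊎ x ∈ V₂

  V₁-disjoint-V₂ : ∀ {x} → x ∈ V₁ → x ∉ V₂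
  V₁-disjoint-V₂ {x} x∈V₁ x∈V₂ with V₁-below-V₂ x x x∈V₁ x∈V₂
  ... | inj₁ x<x = <-irrefl x x<x
  ... | inj₂ (x≢x , _) = x≢x refl

  V₁-minimal : ∀ {u t} → u ∈ V₁ → InV t → ¬ t < u
  V₁-minimal {u} {t} u∈V₁ (inj₁ t∈V₁) t<u with t ≟ᶠ u
  ... | yes refl = <-irrefl t t<u
  ... | no t≢u = ∥⇒≮ (V₁-antichain t u t∈V₁ u∈V₁ t≢u) t<u
  V₁-minimal {u} {t} u∈V₁ (inj₂ t∈V₂) t<u with V₁-below-V₂ u t u∈V₁ t∈V₂
  ... | inj₁ u<t = <-irrefl u (<-trans u<t t<u)
  ... | inj₂ (_ , _ , t≮u) = t≮u t<u

  above-V⇒∈V₂ : ∀ {t u} → InV t → t < u → InV u → u ∈ V₂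
  above-V⇒∈V₂ t∈V t<u (inj₁ u∈V₁) = contradiction t<u (V₁-minimal u∈V₁ t∈V)
  above-V⇒∈V₂ t∈V t<u (inj₂ u∈V₂) = u∈V₂

  bottom-of-2+2 : ∀ {x a′ b′ c′ d′} → x ∈ V₁ → c′ ∈ V₂ → d′ ∈ V₂ →
    x ∈ₗ (a′ ∷ b′ ∷ c′ ∷ d′ ∷ []) → x ≡ a′ ⊎ x ≡ b′
  bottom-of-2+2 _    _     _     (here x≡a′)                 = inj₁ x≡a′
  bottom-of-2+2 _    _     _     (there (here x≡b′))         = inj₂ x≡b′
  bottom-of-2+2 x∈V₁ c′∈V₂ _     (there (there (here refl))) = contradiction c′∈V₂ (V₁-disjoint-V₂ x∈V₁)
  bottom-of-2+2 x∈V₁ _     d′∈V₂ (there (there (there (here refl)))) = contradiction d′∈V₂ (V₁-disjoint-V₂ x∈V₁)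

  -- Inside V₁ ∪ V₂ the tops of a (2+2) lie in V₂, so its two points in V₁ are the bottoms.
  Induces22⇒TwoPlusTwo : ∀ {p q r s} → Induces22 P p q r s →
    p ∈ V₁ → q ∈ V₁ → p ≢ q → r ∈ V₂ → s ∈ V₂ →
    ∃ λ r′ → ∃ λ s′ → r′ ∈ V₂ × s′ ∈ V₂ × TwoPlusTwo P p q r′ s′
  Induces22⇒TwoPlusTwo (a′ , b′ , c′ , d′ , a′b′c′d′↭pqrs , abcd′) p∈V₁ q∈V₁ p≢q r∈V₂ s∈V₂
    with All-resp-↭ (↭-sym a′b′c′d′↭pqrs) (inj₁ p∈V₁ ∷ inj₁ q∈V₁ ∷ inj₂ r∈V₂ ∷ inj₂ s∈V₂ ∷ [])
  ... | a′∈V ∷ b′∈V ∷ c′∈V ∷ d′∈V ∷ []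
    with c′∈V₂ ← above-V⇒∈V₂ a′∈V (proj₁ abcd′) c′∈V
       | d′∈V₂ ← above-V⇒∈V₂ b′∈V (proj₁ (proj₂ abcd′)) d′∈V
       | bottom-of-2+2 p∈V₁ c′∈V₂ d′∈V₂ (∈-resp-↭ (↭-sym a′b′c′d′↭pqrs) (here refl))
       | bottom-of-2+2 q∈V₁ c′∈V₂ d′∈V₂ (∈-resp-↭ (↭-sym a′b′c′d′↭pqrs) (there (here refl)))
  ... | inj₁ refl | inj₂ refl = c′ , d′ , c′∈V₂ , d′∈V₂ , abcd′
  ... | inj₂ refl | inj₁ refl = d′ , c′ , d′∈V₂ , c′∈V₂ , TwoPlusTwo-swap P abcd′
  ... | inj₁ refl | inj₁ refl = contradiction refl p≢q
  ... | inj₂ refl | inj₂ refl = contradiction refl p≢q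

  Separated : (Fin N → Set) → Set
  Separated R = ∃ λ p → ∃ λ q → ∃ λ r → ∃ λ s →
    p ∈ V₁ × q ∈ V₁ × R p × ¬ R q × r ∈ V₂ × s ∈ V₂ × TwoPlusTwo P p q r s

  module _ {R : Fin N → Set} (R? : Decidable R) where
    private
      A : Subset N
      A = V₁ ∩ fromDec R?

      ∈A⁺ : ∀ {y} → y ∈ V₁ → R y → y ∈ A
      ∈A⁺ y∈V₁ Ry = x∈p∩q⁺ (y∈V₁ , ∈-fromDec⁺ R? Ry)

      ∈A⁻ : ∀ {y} → y ∈ A → y ∈ V₁ × R y
      ∈A⁻ y∈A with y∈V₁ , y∈R ← x∈p∩q⁻ V₁ (fromDec R?) y∈A = y∈V₁ , ∈-fromDec⁻ R? y∈R

    separate : ∀ {x u} → x ∈ V₁ → R x → u ∈ V₁ → ¬ R u → Separated R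
    separate {x} {u} x∈V₁ Rx u∈V₁ ¬Ru
      with p , q , _ , _ , p∈A , q∈V₁─A , r∈V₂ , s∈V₂ , pqrs
             ← V₁-separated A (x , ∈A⁺ x∈V₁ Rx) (p∩q⊆p V₁ (fromDec R?) , u , u∈V₁ , ¬Ru ∘ proj₂ ∘ ∈A⁻)
      with p∈V₁ , Rp ← ∈A⁻ p∈A
      with q∈V₁ ← p─q⊆p V₁ A q∈V₁─A | q∉A ← x∈p─q⇒x∉q q∈V₁─A
      with r′ , s′ , r′∈V₂ , s′∈V₂ , pqr′s′
             ← Induces22⇒TwoPlusTwo pqrs p∈V₁ q∈V₁ (λ { refl → q∉A p∈A }) r∈V₂ s∈V₂
      = p , q , r′ , s′ , p∈V₁ , q∈V₁ , Rp , q∉A ∘ ∈A⁺ q∈V₁ , r′∈V₂ , s′∈V₂ , pqr′s′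

  below-V₁-uniform : ∀ {z u} → z < u → u ∈ V₁ → ∀ {u′} → u′ ∈ V₁ → z < u′
  below-V₁-uniform {z} z<u u∈V₁ {u′} u′∈V₁ with z <? u′
  ... | yes z<u′ = z<u′
  ... | no z≮u′
    with p , q , r , _ , _ , _ , z<p , z≮q , _ , _ , (p<r , _ , p∥q , _ , q∥r , _)
           ← separate (z <?_) u∈V₁ z<u u′∈V₁ z≮u′
    = ⊥-elim (free z p r q z<p p<r q∥z (∥-sym p∥q) q∥r)
    where
    q∥z : q ∥ z
    q∥z = (λ { refl → ∥⇒≯ p∥q z<p }) , (λ q<z → ∥⇒≯ p∥q (<-trans q<z z<p)) , z≮q

  between⇒above-V₁ : ∀ {u w y} → u ∈ V₁ → w ∈ V₂ → u < y → y < w → ∀ {t} → t ∈ V₁ → t < y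
  between⇒above-V₁ {u} {w} {y} u∈V₁ w∈V₂ u<y y<w {t} t∈V₁ with t <? y
  ... | yes t<y = t<y
  ... | no t≮y
    with p , q , _ , s , _ , _ , p<y , q≮y , _ , s∈V₂ , (_ , q<s , _ , p∥s , _ , _)
           ← separate (_<? y) u∈V₁ u<y t∈V₁ t≮y
    = ⊥-elim (free p y w s p<y y<w (∥-sym p∥s) s∥y s∥w)
    where
    s∥y : s ∥ y
    s∥y = (λ { refl → q≮y q<s }) , (λ s<y → q≮y (<-trans q<s s<y)) , (λ y<s → ∥⇒≮ p∥s (<-trans p<y y<s))
    s∥w : s ∥ w
    s∥w = V₂-antichain s w s∈V₂ w∈V₂ (λ { refl → ∥⇒≮ p∥s (<-trans p<y y<w) })

module Sides {N} (𝒜 : Admissible N) where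
  open Admissible 𝒜
  open Order P
  open LowerSide 𝒜 public
  private
    -- Upper.* are the statements of LowerSide with the order reversed and V₁, V₂ exchanged.
    module Upper = LowerSide (opposite 𝒜)

    a<c : a < c
    a<c = proj₁ abcd

    a∥d : a ∥ d
    a∥d = proj₁ (proj₂ (proj₂ (proj₂ abcd)))

    b∥c : b ∥ c
    b∥c = proj₁ (proj₂ (proj₂ (proj₂ (proj₂ abcd))))

  V₂-disjoint-V₁ : ∀ {x} → x ∈ V₂ → x ∉ V₁
  V₂-disjoint-V₁ = Upper.V₁-disjoint-V₂

  V₂-maximal : ∀ {u t} → u ∈ V₂ → InV t → ¬ u < t
  V₂-maximal u∈V₂ t∈V = Upper.V₁-minimal u∈V₂ (Sum.swap t∈V)

  above-V₂-uniform : ∀ {z u} → u < z → u ∈ V₂ → ∀ {u′} → u′ ∈ V₂ → u′ < z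
  above-V₂-uniform = Upper.below-V₁-uniform

  Separated₂ : (Fin N → Set) → Set
  Separated₂ R = ∃ λ p → ∃ λ q → ∃ λ r → ∃ λ s →
    p ∈ V₂ × q ∈ V₂ × R p × ¬ R q × r ∈ V₁ × s ∈ V₁ × TwoPlusTwo P r s p q

  separate₂ : ∀ {R} → Decidable R → ∀ {x u} → x ∈ V₂ → R x → u ∈ V₂ → ¬ R u → Separated₂ R
  separate₂ R? x∈V₂ Rx u∈V₂ ¬Ru
    with p , q , r , s , p∈V₂ , q∈V₂ , Rp , ¬Rq , r∈V₁ , s∈V₁ , pqrs ← Upper.separate R? x∈V₂ Rx u∈V₂ ¬Ru
    = p , q , r , s , p∈V₂ , q∈V₂ , Rp , ¬Rq , r∈V₁ , s∈V₁ , TwoPlusTwo-ᵒᵖ (P ᵒᵖ) pqrs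

  below-V₁⇒below-V₂ : ∀ {z} → (∀ {u} → u ∈ V₁ → z < u) → ∀ {w} → w ∈ V₂ → z < w
  below-V₁⇒below-V₂ {z} z<V₁ {w} w∈V₂ with z <? w
  ... | yes z<w = z<w
  ... | no z≮w
    with _ , q , _ , s , _ , _ , _ , z≮q , _ , s∈V₁ , (_ , s<q , _)
           ← separate₂ (z <?_) c∈V₂ (<-trans (z<V₁ a∈V₁) a<c) w∈V₂ z≮w
    = contradiction (<-trans (z<V₁ s∈V₁) s<q) z≮q

  nothing-between : ∀ {u w y} → u ∈ V₁ → w ∈ V₂ → u < y → y < w → ⊥
  nothing-between u∈V₁ w∈V₂ u<y y<w =
    ∥⇒≮ a∥d (<-trans (between⇒above-V₁ u∈V₁ w∈V₂ u<y y<w a∈V₁)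
                     (Upper.between⇒above-V₁ w∈V₂ u∈V₁ y<w u<y d∈V₂))

  ∥-V₁-uniform : ∀ {x z w} → x ∉ V₁ → x < z → z ∈ V₂ → w ∈ V₁ → w ∥ x → ∀ {u} → u ∈ V₁ → u ∥ x
  ∥-V₁-uniform x∉V₁ x<z z∈V₂ w∈V₁ w∥x u∈V₁ =
    (λ { refl → x∉V₁ u∈V₁ }) ,
    (λ u<x → nothing-between u∈V₁ z∈V₂ u<x x<z) ,
    (λ x<u → ∥⇒≯ w∥x (below-V₁-uniform x<u u∈V₁ w∈V₁))

  no-chain-∥-V₁-below-V₂ : ∀ {x y z} → x < y → y < z → z ∈ V₂ →
    (∀ {u} → u ∈ V₁ → u ∥ x) → (∀ {u} → u ∈ V₁ → u ∥ y) → ⊥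
  no-chain-∥-V₁-below-V₂ {x} {y} x<y y<z z∈V₂ V₁∥x V₁∥y with y <? c
  ... | yes y<c = free x y c b x<y y<c (V₁∥x b∈V₁) (V₁∥y b∈V₁) b∥c
  ... | no y≮c
    with p , _ , _ , s , _ , _ , y<p , _ , _ , s∈V₁ , (_ , _ , _ , _ , s∥p , _)
           ← separate₂ (y <?_) z∈V₂ y<z c∈V₂ y≮c
    = free x y p s x<y y<p (V₁∥x s∈V₁) (V₁∥y s∈V₁) s∥p

  no-∥-outside-below-V : ∀ {x w y z} → (∀ {u} → u ∈ V₁ → x < u) → (∀ {u} → u ∈ V₂ → x < u) →
    w ∉ V₁ → w ∉ V₂ → w ∥ x → y ∈ V₁ → ¬ w < y → z ∈ V₂ → ¬ w < z → ⊥
  no-∥-outside-below-V {x} {w} x<V₁ x<V₂ w∉V₁ w∉V₂ w∥x y∈V₁ w≮y z∈V₂ w≮z = by-cases (w <? c)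
    where
    w∥V₁ : ∀ {t} → t ∈ V₁ → w ∥ t
    w∥V₁ t∈V₁ =
      (λ { refl → w∉V₁ t∈V₁ }) ,
      (λ w<t → w≮y (below-V₁-uniform w<t t∈V₁ y∈V₁)) ,
      (λ t<w → ∥⇒≯ w∥x (<-trans (x<V₁ t∈V₁) t<w))

    w∥V₂ : ∀ {t} → t ∈ V₂ → ¬ w < t → w ∥ t
    w∥V₂ t∈V₂ w≮t = (λ { refl → w∉V₂ t∈V₂ }) , w≮t , (λ t<w → ∥⇒≯ w∥x (<-trans (x<V₂ t∈V₂) t<w))

    by-cases : Dec (w < c) → ⊥
    by-cases (no w≮c) = free x a c w (x<V₁ a∈V₁) a<c w∥x (w∥V₁ a∈V₁) (w∥V₂ c∈V₂ w≮c)
    by-cases (yes w<c)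
      with _ , q , _ , s , _ , q∈V₂ , _ , w≮q , _ , s∈V₁ , (_ , s<q , _)
             ← separate₂ (w <?_) c∈V₂ w<c z∈V₂ w≮z
      = free x s q w (x<V₁ s∈V₁) s<q w∥x (w∥V₁ s∈V₁) (w∥V₂ q∈V₂ w≮q)

  no-3+1-isolated-in-V₁ : ∀ {x y z w} → w ∈ V₁ → x < y → y < z → ¬ (y ∈ V₁ × z ∈ V₂) →
    w ∥ x → w ∥ y → (z ∉ V₂ → w ∥ z) → ⊥
  no-3+1-isolated-in-V₁ {x} {y} {z} {w} w∈V₁ x<y y<z ¬y∈V₁×z∈V₂ w∥x w∥y w∥z with z ∈? V₂
  ... | no z∉V₂ = free x y z w x<y y<z w∥x w∥y (w∥z z∉V₂)
  ... | yes z∈V₂ =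
    no-chain-∥-V₁-below-V₂ x<y y<z z∈V₂
      (∥-V₁-uniform (λ x∈V₁ → nothing-between x∈V₁ z∈V₂ x<y y<z) (<-trans x<y y<z) z∈V₂ w∈V₁ w∥x)
      (∥-V₁-uniform (λ y∈V₁ → ¬y∈V₁×z∈V₂ (y∈V₁ , z∈V₂)) y<z z∈V₂ w∈V₁ w∥y)

-- Any relation S between V₁ and V₂ gives a (3+1)-free poset; H_k is the case S x y = ¬ AmongFirst x.
module Rewired {N} (𝒜 : Admissible N) (S : Fin N → Fin N → Set) (S? : ∀ x y → Dec (S x y)) where
  open Admissible 𝒜
  open Order P
  open Sides 𝒜
  private
    module Op = Sides (opposite 𝒜)

  Crossing : Fin N → Fin N → Set
  Crossing x y = x ∈ V₁ × y ∈ V₂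

  infix 4 _≺_
  _≺_ : Fin N → Fin N → Set
  x ≺ y = (¬ Crossing x y × x < y) ⊎ (Crossing x y × S x y)

  below-V₁⇒below-V : ∀ {x t w} → x < t → t ∈ V₁ → InV w → x < w
  below-V₁⇒below-V x<t t∈V₁ (inj₁ w∈V₁) = below-V₁-uniform x<t t∈V₁ w∈V₁
  below-V₁⇒below-V x<t t∈V₁ (inj₂ w∈V₂) = below-V₁⇒below-V₂ (below-V₁-uniform x<t t∈V₁) w∈V₂

  above-V₂⇒above-V : ∀ {x t w} → t < x → t ∈ V₂ → InV w → w < x
  above-V₂⇒above-V t<x t∈V₂ (inj₁ w∈V₁) = Op.below-V₁⇒below-V₂ (above-V₂-uniform t<x t∈V₂) w∈V₁
  above-V₂⇒above-V t<x t∈V₂ (inj₂ w∈V₂) = above-V₂-uniform t<x t∈V₂ w∈V₂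

  below-V₁⇒≺-V : ∀ {x t w} → x < t → t ∈ V₁ → InV w → x ≺ w
  below-V₁⇒≺-V x<t t∈V₁ w∈V =
    inj₁ ((λ (x∈V₁ , _) → V₁-minimal t∈V₁ (inj₁ x∈V₁) x<t) , below-V₁⇒below-V x<t t∈V₁ w∈V)

  above-V₂⇒V-≺ : ∀ {x t w} → t < x → t ∈ V₂ → InV w → w ≺ x
  above-V₂⇒V-≺ t<x t∈V₂ w∈V =
    inj₁ ((λ (_ , x∈V₂) → V₂-maximal t∈V₂ (inj₂ x∈V₂) t<x) , above-V₂⇒above-V t<x t∈V₂ w∈V)

  ≺-irrefl : ∀ x → ¬ x ≺ x
  ≺-irrefl x (inj₁ (_ , x<x))             = <-irrefl x x<x
  ≺-irrefl x (inj₂ ((x∈V₁ , x∈V₂) , _)) = V₁-disjoint-V₂ x∈V₁ x∈V₂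

  ≺-trans : ∀ {x y z} → x ≺ y → y ≺ z → x ≺ z
  ≺-trans (inj₁ (_ , x<y)) (inj₁ (_ , y<z)) =
    inj₁ ((λ (x∈V₁ , z∈V₂) → nothing-between x∈V₁ z∈V₂ x<y y<z) , <-trans x<y y<z)
  ≺-trans (inj₁ (_ , x<y)) (inj₂ ((y∈V₁ , z∈V₂) , _)) = below-V₁⇒≺-V x<y y∈V₁ (inj₂ z∈V₂)
  ≺-trans (inj₂ ((x∈V₁ , y∈V₂) , _)) (inj₁ (_ , y<z)) = above-V₂⇒V-≺ y<z y∈V₂ (inj₁ x∈V₁)
  ≺-trans (inj₂ ((_ , y∈V₂) , _)) (inj₂ ((y∈V₁ , _) , _)) = ⊥-elim (V₁-disjoint-V₂ y∈V₁ y∈V₂)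

  _≺?_ : ∀ x y → Dec (x ≺ y)
  x ≺? y = (¬? (x ∈? V₁ ×-dec y ∈? V₂) ×-dec x <? y) ⊎-dec ((x ∈? V₁ ×-dec y ∈? V₂) ×-dec S? x y)

  Q : FinPoset N
  Q = record { _<P_ = _≺_ ; irrefl = ≺-irrefl ; trans = ≺-trans ; dec = _≺?_ }

  open Order Q public using () renaming (∥⇒≮ to ∥Q⇒⊀; ∥⇒≯ to ∥Q⇒⊁; ∥-sym to ∥Q-sym)

  ∥Q⇒∥ : ∀ {x y} → ¬ Crossing x y → ¬ Crossing y x → Incomp Q x y → x ∥ y
  ∥Q⇒∥ ¬x↝y ¬y↝x (x≢y , x⊀y , y⊀x) =
    x≢y , (λ x<y → x⊀y (inj₁ (¬x↝y , x<y))) , (λ y<x → y⊀x (inj₁ (¬y↝x , y<x)))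

  ∥⇒∥Q : ∀ {x y} → ¬ Crossing x y → ¬ Crossing y x → x ∥ y → Incomp Q x y
  ∥⇒∥Q ¬x↝y ¬y↝x (x≢y , x≮y , y≮x) =
    x≢y , [ x≮y ∘ proj₂ , ¬x↝y ∘ proj₁ ] , [ y≮x ∘ proj₂ , ¬y↝x ∘ proj₁ ]

  crossing⇒∥Q : ∀ {x y} → Crossing x y → ¬ S x y → Incomp Q x y
  crossing⇒∥Q (x∈V₁ , y∈V₂) ¬Sxy =
    (λ { refl → V₁-disjoint-V₂ x∈V₁ y∈V₂ }) ,
    [ (λ (¬x↝y , _) → ¬x↝y (x∈V₁ , y∈V₂)) , ¬Sxy ∘ proj₂ ] ,
    [ V₁-minimal x∈V₁ (inj₂ y∈V₂) ∘ proj₂ , (λ ((y∈V₁ , _) , _) → V₁-disjoint-V₂ y∈V₁ y∈V₂) ]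

  ∥Q⇒∥-outside : ∀ {w t} → w ∉ V₁ → w ∉ V₂ → Incomp Q w t → w ∥ t
  ∥Q⇒∥-outside w∉V₁ w∉V₂ = ∥Q⇒∥ (w∉V₁ ∘ proj₁) (w∉V₂ ∘ proj₂)

  ∥Q⇒∥-V₁ : ∀ {w t} → w ∈ V₁ → t ∉ V₂ → Incomp Q w t → w ∥ t
  ∥Q⇒∥-V₁ w∈V₁ t∉V₂ = ∥Q⇒∥ (t∉V₂ ∘ proj₂) (V₁-disjoint-V₂ w∈V₁ ∘ proj₂)

  ∥Q⇒∥-V₂ : ∀ {w t} → w ∈ V₂ → t ∉ V₁ → Incomp Q w t → w ∥ t
  ∥Q⇒∥-V₂ w∈V₂ t∉V₁ = ∥Q⇒∥ (V₂-disjoint-V₁ w∈V₂ ∘ proj₁) (t∉V₁ ∘ proj₁)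

  locate : ∀ x → InV x ⊎ (x ∉ V₁ × x ∉ V₂)
  locate x with x ∈? V₁ | x ∈? V₂
  ... | yes x∈V₁ | _        = inj₁ (inj₁ x∈V₁)
  ... | no _     | yes x∈V₂ = inj₁ (inj₂ x∈V₂)
  ... | no x∉V₁  | no x∉V₂  = inj₂ (x∉V₁ , x∉V₂)

  no-3+1-<-< : ∀ {x y z w} → x < y → y < z → ¬ Crossing x y → ¬ Crossing y z →
    Incomp Q w x → Incomp Q w y → Incomp Q w z → ⊥
  no-3+1-<-< {x} {y} {z} {w} x<y y<z ¬x↝y ¬y↝z w∥x w∥y w∥z with locate w
  ... | inj₂ (w∉V₁ , w∉V₂) =
    free x y z w x<y y<z (∥Q⇒∥-outside w∉V₁ w∉V₂ w∥x) (∥Q⇒∥-outside w∉V₁ w∉V₂ w∥y) (∥Q⇒∥-outside w∉V₁ w∉V₂ w∥z)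
  ... | inj₁ (inj₁ w∈V₁) with x ∈? V₂ | y ∈? V₂
  ...   | yes x∈V₂ | _        = ∥Q⇒⊀ w∥y (above-V₂⇒V-≺ x<y x∈V₂ (inj₁ w∈V₁))
  ...   | no _     | yes y∈V₂ = ∥Q⇒⊀ w∥z (above-V₂⇒V-≺ y<z y∈V₂ (inj₁ w∈V₁))
  ...   | no x∉V₂  | no y∉V₂  =
    no-3+1-isolated-in-V₁ w∈V₁ x<y y<z ¬y↝z
      (∥Q⇒∥-V₁ w∈V₁ x∉V₂ w∥x) (∥Q⇒∥-V₁ w∈V₁ y∉V₂ w∥y) (λ z∉V₂ → ∥Q⇒∥-V₁ w∈V₁ z∉V₂ w∥z)
  no-3+1-<-< {x} {y} {z} {w} x<y y<z ¬x↝y ¬y↝z w∥x w∥y w∥z | inj₁ (inj₂ w∈V₂) with z ∈? V₁ | y ∈? V₁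
  ...   | yes z∈V₁ | _        = ∥Q⇒⊁ w∥x (below-V₁⇒≺-V (<-trans x<y y<z) z∈V₁ (inj₂ w∈V₂))
  ...   | no _     | yes y∈V₁ = ∥Q⇒⊁ w∥x (below-V₁⇒≺-V x<y y∈V₁ (inj₂ w∈V₂))
  ...   | no z∉V₁  | no y∉V₁  =
    Op.no-3+1-isolated-in-V₁ w∈V₂ y<z x<y (¬x↝y ∘ Product.swap)
      (Incomp-ᵒᵖ P (∥Q⇒∥-V₂ w∈V₂ z∉V₁ w∥z)) (Incomp-ᵒᵖ P (∥Q⇒∥-V₂ w∈V₂ y∉V₁ w∥y))
      (λ x∉V₁ → Incomp-ᵒᵖ P (∥Q⇒∥-V₂ w∈V₂ x∉V₁ w∥x))

  no-3+1-<-crossing : ∀ {x y z w} → x < y → y ∈ V₁ → z ∈ V₂ →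
    Incomp Q w x → Incomp Q w y → Incomp Q w z → ⊥
  no-3+1-<-crossing {x} {y} {z} {w} x<y y∈V₁ z∈V₂ w∥x w∥y w∥z with locate w
  ... | inj₁ w∈V = ∥Q⇒⊁ w∥x (below-V₁⇒≺-V x<y y∈V₁ w∈V)
  ... | inj₂ (w∉V₁ , w∉V₂) =
    no-∥-outside-below-V x<V₁ (below-V₁⇒below-V₂ x<V₁) w∉V₁ w∉V₂ (∥Q⇒∥-outside w∉V₁ w∉V₂ w∥x)
      y∈V₁ (∥⇒≮ (∥Q⇒∥-outside w∉V₁ w∉V₂ w∥y)) z∈V₂ (∥⇒≮ (∥Q⇒∥-outside w∉V₁ w∉V₂ w∥z))
    where
    x<V₁ : ∀ {u} → u ∈ V₁ → x < u
    x<V₁ = below-V₁-uniform x<y y∈V₁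

  no-3+1-crossing-< : ∀ {x y z w} → x ∈ V₁ → y ∈ V₂ → y < z →
    Incomp Q w x → Incomp Q w y → Incomp Q w z → ⊥
  no-3+1-crossing-< {x} {y} {z} {w} x∈V₁ y∈V₂ y<z w∥x w∥y w∥z with locate w
  ... | inj₁ w∈V = ∥Q⇒⊀ w∥z (above-V₂⇒V-≺ y<z y∈V₂ w∈V)
  ... | inj₂ (w∉V₁ , w∉V₂) =
    Op.no-∥-outside-below-V V₂<z (Op.below-V₁⇒below-V₂ V₂<z) w∉V₂ w∉V₁
      (Incomp-ᵒᵖ P (∥Q⇒∥-outside w∉V₁ w∉V₂ w∥z))
      y∈V₂ (∥⇒≯ (∥Q⇒∥-outside w∉V₁ w∉V₂ w∥y)) x∈V₁ (∥⇒≯ (∥Q⇒∥-outside w∉V₁ w∉V₂ w∥x))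
    where
    V₂<z : ∀ {u} → u ∈ V₂ → u < z
    V₂<z = above-V₂-uniform y<z y∈V₂

  ≺-free : ThreePlusOneFree Q
  ≺-free x y z w (inj₁ (¬x↝y , x<y)) (inj₁ (¬y↝z , y<z)) = no-3+1-<-< x<y y<z ¬x↝y ¬y↝z
  ≺-free x y z w (inj₁ (_ , x<y)) (inj₂ ((y∈V₁ , z∈V₂) , _)) = no-3+1-<-crossing x<y y∈V₁ z∈V₂
  ≺-free x y z w (inj₂ ((x∈V₁ , y∈V₂) , _)) (inj₁ (_ , y<z)) = no-3+1-crossing-< x∈V₁ y∈V₂ y<z
  ≺-free x y z w (inj₂ ((_ , y∈V₂) , _)) (inj₂ ((y∈V₁ , _) , _)) _ _ _ = V₁-disjoint-V₂ y∈V₁ y∈V₂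

module Hk {N} (𝒜 : Admissible N) {m} (v : Fin m → Fin N) (k : ℕ) (v∈V₁ : ∀ i → v i ∈ Admissible.V₁ 𝒜) where
  open Admissible 𝒜
  open Sides 𝒜

  AmongFirst : Fin N → Set
  AmongFirst x = ∃ λ i → toℕ i ℕ.< k × v i ≡ x

  AmongFirst? : ∀ x → Dec (AmongFirst x)
  AmongFirst? x = any? λ i → toℕ i ℕ.<? k ×-dec v i ≟ᶠ x

  open Rewired 𝒜 (λ x _ → ¬ AmongFirst x) (λ x _ → ¬? (AmongFirst? x)) public

  ⊀⇒AmongFirst : ∀ {x y} → x ∈ V₁ → y ∈ V₂ → ¬ x ≺ y → AmongFirst x
  ⊀⇒AmongFirst {x} x∈V₁ y∈V₂ x⊀y =
    decidable-stable (AmongFirst? x) (λ ¬first → x⊀y (inj₂ ((x∈V₁ , y∈V₂) , ¬first)))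

  HEdge⇒∥Q : ∀ {x y} → HEdge P V₁ V₂ v k x y → Incomp Q x y
  HEdge⇒∥Q (_ , inj₁ (x∥y , inj₁ (x∉V₁ , x∉V₂))) = ∥⇒∥Q (x∉V₁ ∘ proj₁) (x∉V₂ ∘ proj₂) x∥y
  HEdge⇒∥Q (_ , inj₁ (x∥y , inj₂ (y∉V₁ , y∉V₂))) = ∥⇒∥Q (y∉V₂ ∘ proj₂) (y∉V₁ ∘ proj₁) x∥y
  HEdge⇒∥Q {x} {y} (x≢y , inj₂ (inj₁ (x∈V₁ , y∈V₁))) =
    ∥⇒∥Q (V₁-disjoint-V₂ y∈V₁ ∘ proj₂) (V₁-disjoint-V₂ x∈V₁ ∘ proj₂) (V₁-antichain x y x∈V₁ y∈V₁ x≢y)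
  HEdge⇒∥Q {x} {y} (x≢y , inj₂ (inj₂ (inj₁ (x∈V₂ , y∈V₂)))) =
    ∥⇒∥Q (V₂-disjoint-V₁ x∈V₂ ∘ proj₁) (V₂-disjoint-V₁ y∈V₂ ∘ proj₁) (V₂-antichain x y x∈V₂ y∈V₂ x≢y)
  HEdge⇒∥Q (_ , inj₂ (inj₂ (inj₂ (inj₁ (x-first@(i , _ , refl) , y∈V₂))))) =
    crossing⇒∥Q (v∈V₁ i , y∈V₂) (λ ¬x-first → ¬x-first x-first)
  HEdge⇒∥Q (_ , inj₂ (inj₂ (inj₂ (inj₂ (y-first@(i , _ , refl) , x∈V₂))))) =
    ∥Q-sym (crossing⇒∥Q (v∈V₁ i , x∈V₂) (λ ¬y-first → ¬y-first y-first))

  ∥Q⇒HEdge : ∀ {x y} → Incomp Q x y → HEdge P V₁ V₂ v k x y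
  ∥Q⇒HEdge {x} {y} x∥y@(x≢y , x⊀y , y⊀x) with locate x | locate y
  ... | inj₂ x∉V | _ = x≢y , inj₁ (∥Q⇒∥-outside (proj₁ x∉V) (proj₂ x∉V) x∥y , inj₁ x∉V)
  ... | _ | inj₂ y∉V = x≢y , inj₁ (∥Q⇒∥ (proj₂ y∉V ∘ proj₂) (proj₁ y∉V ∘ proj₁) x∥y , inj₂ y∉V)
  ... | inj₁ (inj₁ x∈V₁) | inj₁ (inj₁ y∈V₁) = x≢y , inj₂ (inj₁ (x∈V₁ , y∈V₁))
  ... | inj₁ (inj₂ x∈V₂) | inj₁ (inj₂ y∈V₂) = x≢y , inj₂ (inj₂ (inj₁ (x∈V₂ , y∈V₂)))
  ... | inj₁ (inj₁ x∈V₁) | inj₁ (inj₂ y∈V₂) = x≢y , inj₂ (inj₂ (inj₂ (inj₁ (⊀⇒AmongFirst x∈V₁ y∈V₂ x⊀y , y∈V₂))))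
  ... | inj₁ (inj₂ x∈V₂) | inj₁ (inj₁ y∈V₁) = x≢y , inj₂ (inj₂ (inj₂ (inj₂ (⊀⇒AmongFirst y∈V₁ x∈V₂ y⊀x , x∈V₂))))

lemma5p14 : (N : ℕ) (P : FinPoset N) → ThreePlusOneFree P →
    (a b c d : Fin N) → TwoPlusTwo P a b c d →
    (V₁ V₂ : Subset N) → MaximalPair P a b c d V₁ V₂ →
    (m : ℕ) (v : Fin m → Fin N) → Enumerates v V₁ →
    (k : ℕ) → k ≤ m →
    Σ (FinPoset N) λ Q → ThreePlusOneFree Q × IsIncomparabilityGraphOf (HEdge P V₁ V₂ v k) Q
lemma5p14 N P free a b c d abcd V₁ V₂ (conditions , _) m v (_ , v-image) k _ =
  Q , ≺-free , λ x y → HEdge⇒∥Q , ∥Q⇒HEdge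
  where
  open Hk (admissible P free abcd conditions) v k (λ i → proj₂ (v-image (v i)) i refl)
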